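{- Let $N$ be a chain-group on $V$ to $K$. Then $\lambda_N$ is submodular: for all $X,Y\subseteq V$, \[\lambda_N(X)+\lambda_N(Y)\ge\lambda_N(X\cup Y)+\lambda_N(X\cap Y).\]
   Context: $\mathbb{F}$ is a field and $K=\mathbb{F}^2$ (with a bilinear form $\langle\,,\,\rangle_K$ equal to $ad+bc$ or $ad-bc$ on $\binom ab,\binom cd$). A chain on a finite set $V$ to $K$ is a map $V\to K$; a chain-group is a subspace $N$ of $K^V$. For $T\subseteq V$, $N\times T=\{f|_T: f\in N,\ f(x)=0\ \forall x\in V\setminus T\}$. The connectivity function is $\lambda_N(U)=\frac12(\dim N-\dim(N\times(V\setminus U))-\dim(N\times U))$. -}

module Defs where

open import Level using (Level; _⊔_)
open import Data.Nat using (ℕ; zero; suc)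
open import Data.Fin using (Fin)
import Data.Fin as Fin
open import Data.Fin.Subset using (Subset; _∈_; _∉_; ∁)
open import Data.Product using (Σ; ∃; _×_; _,_; proj₁)
open import Data.Integer using (ℤ; +_)
import Data.Integer as ℤ
open import Data.Rational.Unnormalised using (ℚᵘ; _/_)
open import Algebra.Bundles using (CommutativeRing)
open import Relation.Nullary using (¬_)

record Field (c ℓ : Level) : Set (Level.suc (c ⊔ ℓ)) where
  field
    cring      : CommutativeRing c ℓ
  open CommutativeRing cring public
  field
    0≉1        : ¬ (0# ≈ 1#)
    inverse    : ∀ x → ¬ (x ≈ 0#) → Σ Carrier (λ y → x * y ≈ 1#)

-- connectivity function, given the dimensions
-- λ_N(U) = ½ (dim N − dim (N × (V∖U)) − dim (N × U))
connectivity : (dimN dimCompl dimU : ℕ) → ℚᵘ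
connectivity dimN dimCompl dimU = ((+ dimN) ℤ.- (+ dimCompl) ℤ.- (+ dimU)) / 2

module _ {c ℓ : Level} (𝔽 : Field c ℓ) where
  open Field 𝔽

  K : Set c
  K = Carrier × Carrier

  _≈K_ : K → K → Set ℓ
  (a , b) ≈K (c' , d) = (a ≈ c') × (b ≈ d)

  0K : K
  0K = 0# , 0#

  _+K_ : K → K → K
  (a , b) +K (c' , d) = (a + c') , (b + d)

  _·K_ : Carrier → K → K
  s ·K (a , b) = (s * a) , (s * b)

  Chain : ∀ {a} → Set a → Set (a ⊔ c)
  Chain A = A → K

  module _ {a} {A : Set a} where
    _≈C_ : Chain A → Chain A → Set (a ⊔ ℓ)
    f ≈C g = ∀ x → f x ≈K g x

    0C : Chain A
    0C _ = 0K

    _+C_ : Chain A → Chain A → Chain A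
    (f +C g) x = f x +K g x

    _·C_ : Carrier → Chain A → Chain A
    (s ·C f) x = s ·K f x

    lincomb : ∀ {d} → (Fin d → Carrier) → (Fin d → Chain A) → Chain A
    lincomb {zero}  cs bs = 0C
    lincomb {suc d} cs bs = (cs Fin.zero ·C bs Fin.zero) +C lincomb (λ i → cs (Fin.suc i)) (λ i → bs (Fin.suc i))

    record IsSubspace {p} (N : Chain A → Set p) : Set (a ⊔ c ⊔ ℓ ⊔ p) where
      field
        resp  : ∀ {f g} → f ≈C g → N f → N g
        zero∈ : N 0C
        +∈    : ∀ {f g} → N f → N g → N (f +C g)
        ·∈    : ∀ s {f} → N f → N (s ·C f)

    HasDim : ∀ {p} → (Chain A → Set p) → ℕ → Set (a ⊔ c ⊔ ℓ ⊔ p)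
    HasDim N d =
      Σ (Fin d → Chain A) λ b →
        (∀ i → N (b i)) ×
        (∀ (cs : Fin d → Carrier) → lincomb cs b ≈C 0C → ∀ i → cs i ≈ 0#) ×
        (∀ g → N g → Σ (Fin d → Carrier) λ cs → g ≈C lincomb cs b)

  Elem : ∀ {n} → Subset n → Set
  Elem {n} T = Σ (Fin n) (λ x → x ∈ T)

  _×ᶜ_ : ∀ {n p} → (Chain (Fin n) → Set p) → (T : Subset n) → Chain (Elem T) → Set (c ⊔ ℓ ⊔ p)
  (N ×ᶜ T) g = Σ (Chain _) λ f → N f × (∀ x → x ∉ T → f x ≈K 0K) × (∀ (e : Elem T) → f (proj₁ e) ≈K g e)

-- Write d(T) = dim (N × T).  Then 2 λ_N(U) = dim N − d(V∖U) − d(U), so the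
-- theorem follows from supermodularity of d,
--     d(P) + d(Q) ≤ d(P ∪ Q) + d(P ∩ Q),
-- applied once to X, Y and once to their complements (V∖X ∪ V∖Y = V∖(X∩Y),
-- V∖X ∩ V∖Y = V∖(X∪Y)).  Supermodularity is Grassmann's inequality
-- dim U + dim W ≤ dim (U + W) + dim (U ∩ W) for U = N × P, W = N × Q, once
-- chains to K = 𝔽² are flattened into vectors over 𝔽.
module Submission where

open import Defs
open import Level using (Level; _⊔_)
open import Data.Nat using (ℕ; zero; suc; s≤s)
import Data.Nat as ℕ
import Data.Nat.Properties as ℕP
open import Data.Fin using (Fin; zero; suc; punchIn; _↑ˡ_; _↑ʳ_; splitAt)
open import Data.Fin.Properties using (join-splitAt)
open import Data.Fin.Subset using (Subset; _∈_; _∉_; _⊆_; ∁; _∪_; _∩_)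
open import Data.Fin.Subset.Properties
  using (_∈?_; x∈p∩q⁺; x∈p∩q⁻; x∈p∪q⁻; x∈∁p⇒x∉p; x∉p⇒x∈∁p; p⊆p∪q; q⊆p∪q; p∩q⊆p; p∩q⊆q; p⊆q⇒∁p⊇∁q)
open import Data.Bool using (Bool; true; false)
open import Data.Vec.Functional using (Vector; insertAt; _++_; take; drop)
open import Data.Vec.Functional.Properties
  using (insertAt-lookup; insertAt-punchIn; lookup-++ˡ; lookup-++ʳ)
open import Data.Product using (Σ; _×_; _,_; proj₁; proj₂)
open import Data.Sum using (_⊎_; inj₁; inj₂; [_,_]′)
open import Data.Empty using (⊥-elim)
open import Relation.Nullary using (¬_; yes; no)
open import Relation.Nullary.Decidable using (¬¬-excluded-middle; decidable-stable)
open import Relation.Nullary.Negation using (DoubleNegation; ¬¬-map; negated-stable)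
import Relation.Binary.PropositionalEquality as ≡

-- The double-negation monad, at arbitrary universe levels (the library's
-- ¬¬-Monad lives at a single level).  Field equality is not decidable, so the
-- case analyses of Gaussian elimination are only available under ¬¬.
module DoubleNegationMonad where

  pure : ∀ {a} {A : Set a} → A → DoubleNegation A
  pure x ¬x = ¬x x

  _>>=_ : ∀ {a b} {A : Set a} {B : Set b} →
          DoubleNegation A → (A → DoubleNegation B) → DoubleNegation B
  m >>= f = negated-stable (¬¬-map f m)

  ¬¬-shift : ∀ {a m} {B : Fin m → Set a} →
             (∀ k → DoubleNegation (B k)) → DoubleNegation (∀ k → B k)
  ¬¬-shift {m = zero}  h = pure (λ ())
  ¬¬-shift {m = suc m} h =
    h zero >>= λ b₀ → ¬¬-shift (λ k → h (suc k)) >>= λ bs →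
    pure λ { zero → b₀ ; (suc k) → bs k }

open DoubleNegationMonad

-- Finite-dimensional linear algebra over a field 𝔽.  A d-family of vectors in
-- 𝔽^A is a map  u : Fin d → A → 𝔽;  a matrix with m rows and s columns is an
-- m-family in 𝔽^(Fin s).
module LinearAlgebra {c ℓ : Level} (𝔽 : Field c ℓ) where
  open Field 𝔽 hiding (zero)
  open import Algebra.Properties.Semiring.Sum semiring
    using (sum; sum-cong-≋; sum-replicate-zero; sum-remove; ∑-comm; ∑-distrib-+;
           *-distribˡ-sum; *-distribʳ-sum)
  open import Algebra.Properties.Ring ring using (-‿distribʳ-*; -‿distribˡ-*)
  open import Relation.Binary.Reasoning.Setoid setoid

  Family : ∀ {a} → ℕ → Set a → Set (a ⊔ c)
  Family d A = Fin d → A → Carrier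

  infix 8 _·_
  _·_ : ∀ {d} → Vector Carrier d → Vector Carrier d → Carrier
  μ · v = sum (λ t → μ t * v t)

  lc : ∀ {a d} {A : Set a} → Vector Carrier d → Family d A → A → Carrier
  lc μ u x = μ · (λ t → u t x)

  Independent : ∀ {a d} {A : Set a} → Family d A → Set (a ⊔ c ⊔ ℓ)
  Independent u = ∀ μ → (∀ x → lc μ u x ≈ 0#) → ∀ t → μ t ≈ 0#

  sum-zero : ∀ {d} (f : Vector Carrier d) → (∀ t → f t ≈ 0#) → sum f ≈ 0#
  sum-zero {d} f h = trans (sum-cong-≋ h) (sum-replicate-zero d)

  ·-zeroˡ : ∀ {d} (μ v : Vector Carrier d) → (∀ t → μ t ≈ 0#) → μ · v ≈ 0#
  ·-zeroˡ μ v h = sum-zero _ (λ t → trans (*-congʳ (h t)) (zeroˡ _))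

  ·-zeroʳ : ∀ {d} (μ v : Vector Carrier d) → (∀ t → v t ≈ 0#) → μ · v ≈ 0#
  ·-zeroʳ μ v h = sum-zero _ (λ t → trans (*-congˡ (h t)) (zeroʳ _))

  ·-congʳ : ∀ {d} (μ : Vector Carrier d) {v w : Vector Carrier d} →
            (∀ t → v t ≈ w t) → μ · v ≈ μ · w
  ·-congʳ μ h = sum-cong-≋ (λ t → *-congˡ (h t))

  lc-assoc : ∀ {a r d} {A : Set a} (μ : Vector Carrier r) (ν : Family r (Fin d))
             (w : Family d A) x → lc μ (λ t → lc (ν t) w) x ≈ lc (lc μ ν) w x
  lc-assoc μ ν w x = begin
    sum (λ t → μ t * sum (λ j → ν t j * w j x))
      ≈⟨ sum-cong-≋ (λ t → *-distribˡ-sum (μ t) (λ j → ν t j * w j x)) ⟩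
    sum (λ t → sum (λ j → μ t * (ν t j * w j x)))
      ≈⟨ ∑-comm (λ t j → μ t * (ν t j * w j x)) ⟩
    sum (λ j → sum (λ t → μ t * (ν t j * w j x)))
      ≈⟨ sum-cong-≋ (λ j → sum-cong-≋ (λ t → sym (*-assoc (μ t) (ν t j) (w j x)))) ⟩
    sum (λ j → sum (λ t → (μ t * ν t j) * w j x))
      ≈⟨ sum-cong-≋ (λ j → sym (*-distribʳ-sum (w j x) (λ t → μ t * ν t j))) ⟩
    sum (λ j → sum (λ t → μ t * ν t j) * w j x) ∎

  spanned-relation : ∀ {a d i} {A : Set a} {u : Family d A} {δ : Family i A}
    (E : Family d (Fin i)) → (∀ t x → u t x ≈ lc (E t) δ x) →
    ∀ ρ → (∀ l → lc ρ E l ≈ 0#) → ∀ x → lc ρ u x ≈ 0#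
  spanned-relation {u = u} {δ} E hu ρ rel x = begin
    lc ρ u x                  ≈⟨ ·-congʳ ρ (λ t → hu t x) ⟩
    lc ρ (λ t → lc (E t) δ) x ≈⟨ lc-assoc ρ E δ x ⟩
    lc (lc ρ E) δ x           ≈⟨ ·-zeroˡ (lc ρ E) (λ l → δ l x) rel ⟩
    0#                        ∎

  -- An independent family of zero vectors is empty (this is where 0 ≠ 1 enters).
  independent-zeros-empty : ∀ {a r} {A : Set a} (ρ : Family r A) →
    Independent ρ → (∀ q x → ρ q x ≈ 0#) → r ≡.≡ 0
  independent-zeros-empty {r = zero}  ρ ind z = ≡.refl
  independent-zeros-empty {r = suc r} ρ ind z =
    ⊥-elim (0≉1 (sym (ind (λ _ → 1#) (λ x → ·-zeroʳ (λ _ → 1#) (λ q → ρ q x) (λ q → z q x)) zero)))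

  identity : ∀ {m} → Family m (Fin m)
  identity zero    zero    = 1#
  identity zero    (suc _) = 0#
  identity (suc _) zero    = 0#
  identity (suc i) (suc j) = identity i j

  lc-identity : ∀ {m} (μ : Vector Carrier m) j → lc μ identity j ≈ μ j
  lc-identity {suc m} μ zero = begin
    μ zero * 1# + (λ t → μ (suc t)) · (λ _ → 0#)
      ≈⟨ +-cong (*-identityʳ _) (·-zeroʳ (λ t → μ (suc t)) (λ _ → 0#) (λ _ → refl)) ⟩
    μ zero + 0#  ≈⟨ +-identityʳ _ ⟩
    μ zero       ∎
  lc-identity {suc m} μ (suc j) = begin
    μ zero * 0# + lc (λ t → μ (suc t)) identity j
      ≈⟨ +-cong (zeroʳ _) (lc-identity (λ t → μ (suc t)) j) ⟩
    0# + μ (suc j) ≈⟨ +-identityˡ _ ⟩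
    μ (suc j)      ∎

  -- A left kernel of an m × s matrix M of dimension at least m − s: independent
  -- rows ρ with ρ M = 0, as many as rank–nullity guarantees.
  record LeftKernel {m s} (M : Family m (Fin s)) : Set (c ⊔ ℓ) where
    field
      dim         : ℕ
      rows        : Family dim (Fin m)
      independent : Independent rows
      annihilates : ∀ t l → lc (rows t) M l ≈ 0#
      bound       : m ℕ.≤ s ℕ.+ dim

  leftKernel-empty : ∀ {m} (M : Family m (Fin 0)) → LeftKernel M
  leftKernel-empty {m} M = record
    { dim = m ; rows = identity
    ; independent = λ μ h j → trans (sym (lc-identity μ j)) (h j)
    ; annihilates = λ _ () ; bound = ℕP.≤-refl }

  leftKernel-zeroColumn : ∀ {m s} (M : Family m (Fin (suc s))) →
    (∀ k → M k zero ≈ 0#) → LeftKernel (λ j l → M j (suc l)) → LeftKernel M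
  leftKernel-zeroColumn M zeroCol K = record
    { dim = dim ; rows = rows ; independent = independent
    ; annihilates = annihilates′ ; bound = ℕP.m≤n⇒m≤1+n bound }
    where
    open LeftKernel K
    annihilates′ : ∀ t l → lc (rows t) M l ≈ 0#
    annihilates′ t zero    = ·-zeroʳ (rows t) _ zeroCol
    annihilates′ t (suc l) = annihilates t l

  clear-column : ∀ {d} (ρ q a : Vector Carrier d) b →
    (- (ρ · q)) * b + ρ · a ≈ ρ · (λ j → a j - q j * b)
  clear-column ρ q a b = sym (begin
    ρ · (λ j → a j - q j * b)
      ≈⟨ sum-cong-≋ (λ j → distribˡ (ρ j) (a j) (- (q j * b))) ⟩
    sum (λ j → ρ j * a j + ρ j * - (q j * b))
      ≈⟨ ∑-distrib-+ (λ j → ρ j * a j) (λ j → ρ j * - (q j * b)) ⟩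
    ρ · a + sum (λ j → ρ j * - (q j * b))
      ≈⟨ +-congˡ (sum-cong-≋ (λ j → pull-neg (ρ j) (q j))) ⟩
    ρ · a + sum (λ j → (ρ j * q j) * - b)
      ≈⟨ +-congˡ (sym (*-distribʳ-sum (- b) (λ j → ρ j * q j))) ⟩
    ρ · a + (ρ · q) * - b
      ≈⟨ +-congˡ (trans (sym (-‿distribʳ-* _ _)) (-‿distribˡ-* _ _)) ⟩
    ρ · a + (- (ρ · q)) * b
      ≈⟨ +-comm _ _ ⟩
    (- (ρ · q)) * b + ρ · a ∎)
    where
    pull-neg : ∀ x y → x * - (y * b) ≈ (x * y) * - b
    pull-neg x y = trans (sym (-‿distribʳ-* _ _))
                         (trans (-‿cong (sym (*-assoc _ _ _))) (-‿distribʳ-* _ _))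

  -- If the pivot M k 0 is nonzero, subtract
  -- multiples of row k to clear column 0; a left kernel of the remaining
  -- (m × s) matrix lifts to a left kernel of M.
  module Pivot {m s} (M : Family (suc m) (Fin (suc s))) (k : Fin (suc m))
               (pivot≉0 : ¬ (M k zero ≈ 0#)) where

    y : Carrier
    y = proj₁ (inverse (M k zero) pivot≉0)

    q : Vector Carrier m
    q j = M (punchIn k j) zero * y

    reduced : Family m (Fin s)
    reduced j l = M (punchIn k j) (suc l) - q j * M k (suc l)

    column-cleared : ∀ j → M (punchIn k j) zero - q j * M k zero ≈ 0#
    column-cleared j = trans (+-congˡ (-‿cong q*pivot)) (-‿inverseʳ _)
      where
      q*pivot : q j * M k zero ≈ M (punchIn k j) zero
      q*pivot = trans (*-assoc _ _ _)
        (trans (*-congˡ (trans (*-comm _ _) (proj₂ (inverse (M k zero) pivot≉0))))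
               (*-identityʳ _))

    lift : LeftKernel reduced → LeftKernel M
    lift K = record
      { dim = dim ; rows = rows′ ; independent = independent′
      ; annihilates = annihilates′ ; bound = s≤s bound }
      where
      open LeftKernel K
      rows′ : Family dim (Fin (suc m))
      rows′ t = insertAt (rows t) k (- (rows t · q))

      rows′-punchIn : ∀ t j → rows′ t (punchIn k j) ≈ rows t j
      rows′-punchIn t j = reflexive (insertAt-punchIn (rows t) k _ j)

      independent′ : Independent rows′
      independent′ μ h = independent μ (λ j →
        trans (·-congʳ μ (λ t → sym (rows′-punchIn t j))) (h (punchIn k j)))

      annihilates′ : ∀ t l → lc (rows′ t) M l ≈ 0#
      annihilates′ t l = begin
        lc (rows′ t) M l
          ≈⟨ sum-remove {i = k} (λ j → rows′ t j * M j l) ⟩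
        rows′ t k * M k l + sum (λ j → rows′ t (punchIn k j) * M (punchIn k j) l)
          ≈⟨ +-cong (*-congʳ (reflexive (insertAt-lookup (rows t) k _)))
                    (sum-cong-≋ (λ j → *-congʳ (rows′-punchIn t j))) ⟩
        (- (rows t · q)) * M k l + rows t · (λ j → M (punchIn k j) l)
          ≈⟨ clear-column (rows t) q (λ j → M (punchIn k j) l) (M k l) ⟩
        rows t · (λ j → M (punchIn k j) l - q j * M k l)
          ≈⟨ cleared l ⟩
        0# ∎
        where
        cleared : ∀ l → rows t · (λ j → M (punchIn k j) l - q j * M k l) ≈ 0#
        cleared zero    = ·-zeroʳ (rows t) _ column-cleared
        cleared (suc l) = annihilates t l

  -- Rank–nullity (as an inequality): every m × s matrix has a left kernel of
  -- dimension at least m − s.  Gaussian elimination on the first column.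
  leftKernel : ∀ s {m} (M : Family m (Fin s)) → DoubleNegation (LeftKernel M)
  leftKernel zero    M = pure (leftKernel-empty M)
  leftKernel (suc s) {m} M =
    ¬¬-excluded-middle {A = Σ (Fin m) λ k → ¬ (M k zero ≈ 0#)} >>= λ
      { (yes (k , pivot≉0)) → withPivot M k pivot≉0
      ; (no noPivot) →
          ¬¬-shift (λ k k≉0 → noPivot (k , k≉0)) >>= λ zeroCol →
          leftKernel s (λ j l → M j (suc l)) >>= λ K →
          pure (leftKernel-zeroColumn M zeroCol K) }
    where
    withPivot : ∀ {m} (M : Family m (Fin (suc s))) k → ¬ (M k zero ≈ 0#) →
                DoubleNegation (LeftKernel M)
    withPivot {suc m} M k pivot≉0 =
      leftKernel s (Pivot.reduced M k pivot≉0) >>= λ K →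
      pure (Pivot.lift M k pivot≉0 K)

  span-bound : ∀ {a r i} {A : Set a} (u : Family r A) (δ : Family i A)
    (E : Family r (Fin i)) → Independent u → (∀ t x → u t x ≈ lc (E t) δ x) →
    DoubleNegation (r ℕ.≤ i)
  span-bound {r = r} {i} u δ E indu hu = leftKernel i E >>= λ K →
    let open LeftKernel K
        rows≈0 : ∀ q j → rows q j ≈ 0#
        rows≈0 q = indu (rows q) (spanned-relation E hu (rows q) (annihilates q))
        dim≡0 = independent-zeros-empty rows independent rows≈0
        i+dim≡i = ≡.trans (≡.cong (i ℕ.+_) dim≡0) (ℕP.+-identityʳ i)
    in pure (≡.subst (r ℕ.≤_) i+dim≡i bound)

  ↑-elim : ∀ {p a b} (P : Fin (a ℕ.+ b) → Set p) →
           (∀ j → P (j ↑ˡ b)) → (∀ k → P (a ↑ʳ k)) → ∀ j → P j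
  ↑-elim {a = a} {b} P left right j with splitAt a j | join-splitAt a b j
  ... | inj₁ j′ | eq = ≡.subst P eq (left j′)
  ... | inj₂ k  | eq = ≡.subst P eq (right k)

  sum-++ : ∀ {a b} (f : Vector Carrier (a ℕ.+ b)) → sum f ≈ sum (take a f) + sum (drop a f)
  sum-++ {zero}      f = sym (+-identityˡ _)
  sum-++ {suc a} {b} f = trans (+-congˡ (sum-++ {a} {b} (λ j → f (suc j)))) (sym (+-assoc _ _ _))

  lc-++ : ∀ {p a b} {A : Set p} (μ : Vector Carrier (a ℕ.+ b))
          (α : Family a A) (β : Family b A) x →
          lc μ (α ++ β) x ≈ lc (take a μ) α x + lc (drop a μ) β x
  lc-++ {a = a} {b} μ α β x = trans (sum-++ {a} {b} (λ j → μ j * (α ++ β) j x))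
    (+-cong (·-congʳ (take a μ) (λ j → reflexive (≡.cong (λ f → f x) (lookup-++ˡ α β j))))
            (·-congʳ (drop a μ) (λ k → reflexive (≡.cong (λ f → f x) (lookup-++ʳ α β k)))))

  ++-spanned : ∀ {p a b c′} {A : Set p} (α : Family a A) (β : Family b A) (γ : Family c′ A)
    (Mα : Family a (Fin c′)) (Mβ : Family b (Fin c′)) →
    (∀ j x → α j x ≈ lc (Mα j) γ x) → (∀ k x → β k x ≈ lc (Mβ k) γ x) →
    ∀ j x → (α ++ β) j x ≈ lc ((Mα ++ Mβ) j) γ x
  ++-spanned α β γ Mα Mβ hα hβ = ↑-elim (λ j → ∀ x → (α ++ β) j x ≈ lc ((Mα ++ Mβ) j) γ x)
    (λ j x → ≡.subst₂ (λ f g → f x ≈ lc g γ x)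
               (≡.sym (lookup-++ˡ α β j)) (≡.sym (lookup-++ˡ Mα Mβ j)) (hα j x))
    (λ k x → ≡.subst₂ (λ f g → f x ≈ lc g γ x)
               (≡.sym (lookup-++ʳ α β k)) (≡.sym (lookup-++ʳ Mα Mβ k)) (hβ k x))

  relation-parts-independent : ∀ {p a b r} {A : Set p} (α : Family a A) (β : Family b A) →
    Independent α → Independent β → (ρ : Family r (Fin (a ℕ.+ b))) → Independent ρ →
    (∀ t x → lc (ρ t) (α ++ β) x ≈ 0#) → Independent (λ t → lc (take a (ρ t)) α)
  relation-parts-independent {a = a} {b} α β indα indβ ρ indρ rel μ h = indρ μ σ≈0
    where
    σ : Vector Carrier (a ℕ.+ b)
    σ = lc μ ρ
    σ-relation : ∀ x → lc σ (α ++ β) x ≈ 0#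
    σ-relation x = trans (sym (lc-assoc μ ρ (α ++ β) x)) (·-zeroʳ μ _ (λ t → rel t x))
    σˡ≈0 : ∀ j → σ (j ↑ˡ b) ≈ 0#
    σˡ≈0 = indα (take a σ) (λ x → trans (sym (lc-assoc μ (λ t → take a (ρ t)) α x)) (h x))
    σʳ≈0 : ∀ k → σ (a ↑ʳ k) ≈ 0#
    σʳ≈0 = indβ (drop a σ) (λ x → begin
      lc (drop a σ) β x                      ≈⟨ sym (+-identityˡ _) ⟩
      0# + lc (drop a σ) β x                 ≈⟨ +-congʳ (sym (·-zeroˡ (take a σ) _ σˡ≈0)) ⟩
      lc (take a σ) α x + lc (drop a σ) β x  ≈⟨ sym (lc-++ σ α β x) ⟩
      lc σ (α ++ β) x                        ≈⟨ σ-relation x ⟩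
      0#                                     ∎)
    σ≈0 : ∀ j → σ j ≈ 0#
    σ≈0 = ↑-elim (λ j → σ j ≈ 0#) σˡ≈0 σʳ≈0

  -- Grassmann's inequality dim U + dim W ≤ dim (U + W) + dim (U ∩ W), in the form
  -- needed here: U, W are spanned by independent families α, β; both lie in the
  -- span of γ; and every vector of U that also lies in W lies in the span of δ.
  grassmann-bound : ∀ {p a b c′ i} {A : Set p}
    (α : Family a A) (β : Family b A) (γ : Family c′ A) (δ : Family i A) →
    Independent α → Independent β →
    (Mα : Family a (Fin c′)) → (∀ j x → α j x ≈ lc (Mα j) γ x) →
    (Mβ : Family b (Fin c′)) → (∀ j x → β j x ≈ lc (Mβ j) γ x) →
    (∀ cs ds → (∀ x → lc cs α x + lc ds β x ≈ 0#) →
       Σ (Vector Carrier i) λ es → ∀ x → lc cs α x ≈ lc es δ x) →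
    DoubleNegation (a ℕ.+ b ℕ.≤ c′ ℕ.+ i)
  grassmann-bound {a = a} {b} {c′} {i} {A} α β γ δ indα indβ Mα hα Mβ hβ meet =
    leftKernel c′ (Mα ++ Mβ) >>= fromKernel
    where
    fromKernel : LeftKernel (Mα ++ Mβ) → DoubleNegation (a ℕ.+ b ℕ.≤ c′ ℕ.+ i)
    fromKernel K = span-bound parts δ (λ t → proj₁ (parts-in-meet t)) parts-independent
                     (λ t → proj₂ (parts-in-meet t)) >>= λ dim≤i →
                   pure (ℕP.≤-trans bound (ℕP.+-monoʳ-≤ c′ dim≤i))
      where
      open LeftKernel K
      relation : ∀ t x → lc (rows t) (α ++ β) x ≈ 0#
      relation t = spanned-relation (Mα ++ Mβ) (++-spanned α β γ Mα Mβ hα hβ)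
                                    (rows t) (annihilates t)
      parts : Family dim A
      parts t = lc (take a (rows t)) α
      parts-independent : Independent parts
      parts-independent = relation-parts-independent α β indα indβ rows independent relation
      parts-in-meet : ∀ t → Σ (Vector Carrier i) λ es → ∀ x → parts t x ≈ lc es δ x
      parts-in-meet t = meet (take a (rows t)) (drop a (rows t))
                             (λ x → trans (sym (lc-++ (rows t) α β x)) (relation t x))

-- Chain-groups.  A chain on A to K = 𝔽² is flattened to a vector in 𝔽^(A × Bool),
-- so that the linear algebra above applies to the subspaces N × T of K^V.
module ChainGroups {c ℓ p : Level} (𝔽 : Field c ℓ) {n : ℕ}
                   (N : Chain 𝔽 (Fin n) → Set p) (isN : IsSubspace 𝔽 N) where
  open Field 𝔽 hiding (zero)
  open LinearAlgebra 𝔽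
  open IsSubspace isN

  component : Bool → K 𝔽 → Carrier
  component false = proj₁
  component true  = proj₂

  component-cong : ∀ bit {u v} → _≈K_ 𝔽 u v → component bit u ≈ component bit v
  component-cong false = proj₁
  component-cong true  = proj₂

  flatten : ∀ {a} {A : Set a} → Chain 𝔽 A → A × Bool → Carrier
  flatten f (e , bit) = component bit (f e)

  flatten-lincomb : ∀ {a d} {A : Set a} (cs : Vector Carrier d) (bs : Fin d → Chain 𝔽 A) y →
    flatten (lincomb 𝔽 cs bs) y ≈ lc cs (λ t → flatten (bs t)) y
  flatten-lincomb {d = zero}  cs bs (e , false) = refl
  flatten-lincomb {d = zero}  cs bs (e , true)  = refl
  flatten-lincomb {d = suc d} cs bs (e , false) =
    +-congˡ (flatten-lincomb (λ i → cs (suc i)) (λ i → bs (suc i)) (e , false))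
  flatten-lincomb {d = suc d} cs bs (e , true)  =
    +-congˡ (flatten-lincomb (λ i → cs (suc i)) (λ i → bs (suc i)) (e , true))

  lincomb∈N : ∀ {d} (cs : Vector Carrier d) (bs : Fin d → Chain 𝔽 (Fin n)) →
              (∀ t → N (bs t)) → N (lincomb 𝔽 cs bs)
  lincomb∈N {zero}  cs bs h = zero∈
  lincomb∈N {suc d} cs bs h = +∈ (·∈ (cs zero) (h zero))
    (lincomb∈N (λ i → cs (suc i)) (λ i → bs (suc i)) (λ i → h (suc i)))

  -- Elements of N vanishing outside T; their restrictions to T make up N × T.
  SupportedIn : Subset n → Chain 𝔽 (Fin n) → Set (ℓ ⊔ p)
  SupportedIn T h = N h × (∀ x → x ∉ T → _≈K_ 𝔽 (h x) (0K 𝔽))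

  vanishes : ∀ {T h} → SupportedIn T h → ∀ {x} → x ∉ T → ∀ bit → flatten h (x , bit) ≈ 0#
  vanishes (_ , zero-outside) x∉T false = proj₁ (zero-outside _ x∉T)
  vanishes (_ , zero-outside) x∉T true  = proj₂ (zero-outside _ x∉T)

  widen : ∀ {P R h} → P ⊆ R → SupportedIn P h → SupportedIn R h
  widen P⊆R (h∈N , zero-outside) = h∈N , λ x x∉R → zero-outside x (λ x∈P → x∉R (P⊆R x∈P))

  record FlatBasis (T : Subset n) (d : ℕ) : Set (c ⊔ ℓ ⊔ p) where
    field
      chains      : Fin d → Chain 𝔽 (Fin n)
      supported   : ∀ t → SupportedIn T (chains t)
      independent : Independent (λ t → flatten (chains t))
      spans       : ∀ h → SupportedIn T h →
                    Σ (Vector Carrier d) λ cs → ∀ y → flatten h y ≈ lc cs (λ t → flatten (chains t)) y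

    vectors : Family d (Fin n × Bool)
    vectors t = flatten (chains t)

  -- A basis of N × T (as in HasDim) yields a flattened basis: extend each basis
  -- chain by zero outside T, and decide membership in T to transfer spanning.
  flatBasis : ∀ {T d} → HasDim 𝔽 (_×ᶜ_ 𝔽 N T) d → FlatBasis T d
  flatBasis {T} {d} (b , b∈N×T , b-independent , b-spans) = record
    { chains = chains ; supported = supported
    ; independent = independent ; spans = spans }
    where
    chains : Fin d → Chain 𝔽 (Fin n)
    chains t = proj₁ (b∈N×T t)
    supported : ∀ t → SupportedIn T (chains t)
    supported t = let (_ , f∈N , zero-outside , _) = b∈N×T t in f∈N , zero-outside
    extends : ∀ t bit (e : Elem 𝔽 T) → flatten (chains t) (proj₁ e , bit) ≈ component bit (b t e)
    extends t bit e = component-cong bit (proj₂ (proj₂ (proj₂ (b∈N×T t))) e)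
    independent : Independent (λ t → flatten (chains t))
    independent μ h = b-independent μ (λ e → vanish e false , vanish e true)
      where
      vanish : ∀ e bit → component bit (lincomb 𝔽 μ b e) ≈ 0#
      vanish e bit = trans (flatten-lincomb μ b (e , bit))
        (trans (·-congʳ μ (λ t → sym (extends t bit e))) (h (proj₁ e , bit)))
    spans : ∀ h → SupportedIn T h →
            Σ (Vector Carrier d) λ cs → ∀ y → flatten h y ≈ lc cs (λ t → flatten (chains t)) y
    spans h h-supp@(h∈N , zero-outside) = cs , agrees
      where
      restricted : Σ (Vector Carrier d) λ cs → _≈C_ 𝔽 (λ (e : Elem 𝔽 T) → h (proj₁ e)) (lincomb 𝔽 cs b)
      restricted = b-spans (λ e → h (proj₁ e)) (h , h∈N , zero-outside , λ _ → refl , refl)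
      cs : Vector Carrier d
      cs = proj₁ restricted
      agrees : ∀ y → flatten h y ≈ lc cs (λ t → flatten (chains t)) y
      agrees (x , bit) with x ∈? T
      ... | yes x∈T = trans (component-cong bit (proj₂ restricted (x , x∈T)))
                       (trans (flatten-lincomb cs b ((x , x∈T) , bit))
                              (·-congʳ cs (λ t → sym (extends t bit (x , x∈T)))))
      ... | no  x∉T = trans (vanishes h-supp x∉T bit)
                       (sym (·-zeroʳ cs _ (λ t → vanishes (supported t) x∉T bit)))

  outside-meet : ∀ {P Q T : Subset n} → P ∩ Q ⊆ T → ∀ {x} → x ∉ T → x ∉ P ⊎ x ∉ Q
  outside-meet {P} {Q} P∩Q⊆T {x} x∉T with x ∈? P | x ∈? Q
  ... | no  x∉P | _       = inj₁ x∉P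
  ... | yes _   | no  x∉Q = inj₂ x∉Q
  ... | yes x∈P | yes x∈Q = ⊥-elim (x∉T (P∩Q⊆T (x∈p∩q⁺ (x∈P , x∈Q))))

  -- N × P and N × Q both sit inside N × R, and their intersection inside N × T.
  dim-supermodular : ∀ {P Q R T : Subset n} → P ⊆ R → Q ⊆ R → P ∩ Q ⊆ T →
    ∀ {a b c′ i} → HasDim 𝔽 (_×ᶜ_ 𝔽 N P) a → HasDim 𝔽 (_×ᶜ_ 𝔽 N Q) b →
    HasDim 𝔽 (_×ᶜ_ 𝔽 N R) c′ → HasDim 𝔽 (_×ᶜ_ 𝔽 N T) i → a ℕ.+ b ℕ.≤ c′ ℕ.+ i
  dim-supermodular {P} {Q} {R} {T} P⊆R Q⊆R P∩Q⊆T {a} {b} {c′} {i} dimP dimQ dimR dimT =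
    decidable-stable (a ℕ.+ b ℕ.≤? c′ ℕ.+ i)
      (grassmann-bound (vectors BP) (vectors BQ) (vectors BR) (vectors BT)
         (independent BP) (independent BQ)
         (λ t → proj₁ (inR BP P⊆R t)) (λ t → proj₂ (inR BP P⊆R t))
         (λ t → proj₁ (inR BQ Q⊆R t)) (λ t → proj₂ (inR BQ Q⊆R t))
         meet)
    where
    open FlatBasis
    open import Relation.Binary.Reasoning.Setoid setoid

    BP : FlatBasis P a
    BP = flatBasis dimP
    BQ : FlatBasis Q b
    BQ = flatBasis dimQ
    BR : FlatBasis R c′
    BR = flatBasis dimR
    BT : FlatBasis T i
    BT = flatBasis dimT

    inR : ∀ {S d} (B : FlatBasis S d) → S ⊆ R → ∀ t →
          Σ (Vector Carrier c′) λ cs → ∀ y → vectors B t y ≈ lc cs (vectors BR) y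
    inR B S⊆R t = spans BR (chains B t) (widen S⊆R (supported B t))

    -- A vector of N × P that is also in N × Q is supported in P ∩ Q ⊆ T.
    meet : ∀ cs ds → (∀ y → lc cs (vectors BP) y + lc ds (vectors BQ) y ≈ 0#) →
           Σ (Vector Carrier i) λ es → ∀ y → lc cs (vectors BP) y ≈ lc es (vectors BT) y
    meet cs ds relation =
      proj₁ (spans BT h h-in-T) ,
      λ y → trans (sym (flatten-lincomb cs (chains BP) y)) (proj₂ (spans BT h h-in-T) y)
      where
      h : Chain 𝔽 (Fin n)
      h = lincomb 𝔽 cs (chains BP)
      vanishes-off : ∀ {x} → x ∉ P ⊎ x ∉ Q → ∀ bit → flatten h (x , bit) ≈ 0#
      vanishes-off {x} (inj₁ x∉P) bit = trans (flatten-lincomb cs (chains BP) (x , bit))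
        (·-zeroʳ cs _ (λ t → vanishes (supported BP t) x∉P bit))
      vanishes-off {x} (inj₂ x∉Q) bit = trans (flatten-lincomb cs (chains BP) (x , bit)) (begin
        lc cs (vectors BP) (x , bit)                                 ≈⟨ sym (+-identityʳ _) ⟩
        lc cs (vectors BP) (x , bit) + 0#
          ≈⟨ +-congˡ (sym (·-zeroʳ ds _ (λ t → vanishes (supported BQ t) x∉Q bit))) ⟩
        lc cs (vectors BP) (x , bit) + lc ds (vectors BQ) (x , bit)  ≈⟨ relation (x , bit) ⟩
        0#                                                           ∎)
      h-in-T : SupportedIn T h
      h-in-T = lincomb∈N cs (chains BP) (λ t → proj₁ (supported BP t)) ,
               λ x x∉T → vanishes-off (outside-meet P∩Q⊆T x∉T) false
                       , vanishes-off (outside-meet P∩Q⊆T x∉T) true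

module ConnectivityArithmetic where
  open import Data.Integer using (ℤ; +_; _+_; _-_)
  import Data.Integer as ℤ
  import Data.Integer.Properties as ℤP
  open import Data.Integer.Tactic.RingSolver using (solve-∀)
  open import Data.Rational.Unnormalised using (_/_; *≤*)
  import Data.Rational.Unnormalised as ℚ

  halves-mono : ∀ (x y z w : ℤ) → x + y ℤ.≤ z + w → x / 2 ℚ.+ y / 2 ℚ.≤ z / 2 ℚ.+ w / 2
  halves-mono x y z w x+y≤z+w = *≤* (ℤP.*-monoʳ-≤-nonNeg (+ 4)
    (≡.subst₂ ℤ._≤_ (ℤP.*-distribʳ-+ (+ 2) x y) (ℤP.*-distribʳ-+ (+ 2) z w)
      (ℤP.*-monoʳ-≤-nonNeg (+ 2) x+y≤z+w)))

  sum-of-differences : ∀ (d u v i j : ℤ) →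
    (d - u - v) + (d - i - j) ≡.≡ (d + d) - ((u + i) + (v + j))
  sum-of-differences = solve-∀

  pos-+-+ : ∀ (u i v j : ℕ) → + ((u ℕ.+ i) ℕ.+ (v ℕ.+ j)) ≡.≡ (+ u + + i) + (+ v + + j)
  pos-+-+ u i v j = ≡.trans (ℤP.pos-+ (u ℕ.+ i) (v ℕ.+ j))
                            (≡.cong₂ _+_ (ℤP.pos-+ u i) (ℤP.pos-+ v j))

  connectivity-sum-mono : ∀ (d aX bX aY bY aU bU aI bI : ℕ) →
    aX ℕ.+ aY ℕ.≤ aU ℕ.+ aI → bX ℕ.+ bY ℕ.≤ bU ℕ.+ bI →
    connectivity d aU bU ℚ.+ connectivity d aI bI ℚ.≤ connectivity d aX bX ℚ.+ connectivity d aY bY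
  connectivity-sum-mono d aX bX aY bY aU bU aI bI a≤ b≤ =
    halves-mono (+ d - + aU - + bU) (+ d - + aI - + bI) (+ d - + aX - + bX) (+ d - + aY - + bY)
      (≡.subst₂ ℤ._≤_ (≡.sym (sum-of-differences (+ d) (+ aU) (+ bU) (+ aI) (+ bI)))
                      (≡.sym (sum-of-differences (+ d) (+ aX) (+ bX) (+ aY) (+ bY)))
        (ℤP.+-monoʳ-≤ (+ d + + d) (ℤP.neg-mono-≤ removed≤)))
    where
    removed≤ : (+ aX + + aY) + (+ bX + + bY) ℤ.≤ (+ aU + + aI) + (+ bU + + bI)
    removed≤ = ≡.subst₂ ℤ._≤_ (pos-+-+ aX aY bX bY) (pos-+-+ aU aI bU bI)
                 (ℤ.+≤+ (ℕP.+-mono-≤ a≤ b≤))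

open ConnectivityArithmetic using (connectivity-sum-mono)
-- Opened last: these names would clash with the field operations above.
open import Data.Rational.Unnormalised using (_+_; _≤_)

∁∩∁⊆∁∪ : ∀ {n} (X Y : Subset n) → ∁ X ∩ ∁ Y ⊆ ∁ (X ∪ Y)
∁∩∁⊆∁∪ X Y {x} x∈∁X∩∁Y = x∉p⇒x∈∁p λ x∈X∪Y →
  [ x∈∁p⇒x∉p (proj₁ outside) , x∈∁p⇒x∉p (proj₂ outside) ]′ (x∈p∪q⁻ X Y x∈X∪Y)
  where
  outside : x ∈ ∁ X × x ∈ ∁ Y
  outside = x∈p∩q⁻ (∁ X) (∁ Y) x∈∁X∩∁Y

-- Supermodularity of d(T) = dim (N × T), applied to X, Y and to their complements;
-- dim N cancels from the two sides.
theorem3p13 : ∀ {c ℓ p : Level} (𝔽 : Field c ℓ) (n : ℕ)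
    (N : Chain 𝔽 (Fin n) → Set p) → IsSubspace 𝔽 N →
    (X Y : Subset n) →
    (dN aX bX aY bY aU bU aI bI : ℕ) →
    HasDim 𝔽 N dN →
    HasDim 𝔽 (_×ᶜ_ 𝔽 N (∁ X)) aX → HasDim 𝔽 (_×ᶜ_ 𝔽 N X) bX →
    HasDim 𝔽 (_×ᶜ_ 𝔽 N (∁ Y)) aY → HasDim 𝔽 (_×ᶜ_ 𝔽 N Y) bY →
    HasDim 𝔽 (_×ᶜ_ 𝔽 N (∁ (X ∪ Y))) aU → HasDim 𝔽 (_×ᶜ_ 𝔽 N (X ∪ Y)) bU →
    HasDim 𝔽 (_×ᶜ_ 𝔽 N (∁ (X ∩ Y))) aI → HasDim 𝔽 (_×ᶜ_ 𝔽 N (X ∩ Y)) bI →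
    connectivity dN aU bU + connectivity dN aI bI
      ≤ connectivity dN aX bX + connectivity dN aY bY
theorem3p13 𝔽 n N isN X Y dN aX bX aY bY aU bU aI bI _
            dim∁X dimX dim∁Y dimY dim∁X∪Y dimX∪Y dim∁X∩Y dimX∩Y =
  connectivity-sum-mono dN aX bX aY bY aU bU aI bI complements≤ sets≤
  where
  open ChainGroups 𝔽 N isN using (dim-supermodular)
  complements≤ : aX ℕ.+ aY ℕ.≤ aU ℕ.+ aI
  complements≤ = ℕP.≤-trans
    (dim-supermodular (p⊆q⇒∁p⊇∁q (p∩q⊆p X Y)) (p⊆q⇒∁p⊇∁q (p∩q⊆q X Y)) (∁∩∁⊆∁∪ X Y)
                      dim∁X dim∁Y dim∁X∩Y dim∁X∪Y)
    (ℕP.≤-reflexive (ℕP.+-comm aI aU))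
  sets≤ : bX ℕ.+ bY ℕ.≤ bU ℕ.+ bI
  sets≤ = dim-supermodular (p⊆p∪q Y) (q⊆p∪q X Y) (λ x∈X∩Y → x∈X∩Y) dimX dimY dimX∪Y dimX∩Y
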